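{- Let $\mathscr{C}$ be a class closed under inverse length increasing morphisms, let $A$ be an alphabet, and let $L_1,\dots,L_m$ ($m\ge1$) be languages in $[\mathscr{C}](A)$. Then there exists $d\ge1$ such that $L_1,\dots,L_m\in[\mathscr{C}]_d(A)$.
   Context: A class $\mathscr{C}$ assigns to each alphabet $A$ a set $\mathscr{C}(A)$ of regular languages over $A$; it is closed under inverse length increasing morphisms if $\alpha^{ -1}(L)\in\mathscr{C}(A)$ whenever $L\in\mathscr{C}(B)$ and $\alpha:A^*\to B^*$ is a monoid morphism with $\alpha(a)\neq\varepsilon$ for all $a\in A$. For $d\ge1$, $A_d$ is the alphabet whose letters are the nonempty words over $A$ of length at most $d$; $\mu_d:A^*\to A_d^*$ cuts $w$ into consecutive factors of length $d$ from the left, the last factor being of length $<d$ and omitted if empty, and returns the sequence of factors as letters. $[\mathscr{C}]_d(A)=\{\mu_d^{ -1}(K)\mid K\in\mathscr{C}(A_d)\}$ and $[\mathscr{C}](A)=\bigcup_{d\ge1}[\mathscr{C}]_d(A)$. -}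

module Defs where

open import Data.Nat using (ℕ; zero; suc; _≤_; _≤?_; z≤n; s≤s; _⊓_)
open import Data.Nat.Properties using (≤-irrelevant; m⊓n≤m; ≤-trans; ≤-reflexive)
open import Data.Bool using (Bool; T)
open import Data.Fin using (Fin)
open import Data.List using (List; []; _∷_; _++_; length; take; drop; map; concatMap; foldl)
open import Data.List.Properties using (length-take)
import Data.List.Properties as LP
open import Data.List.Membership.Propositional using (_∈_)
open import Data.List.Membership.Propositional.Properties using (∈-map⁺; ∈-concatMap⁺)
open import Data.List.Relation.Unary.Any using (Any; here; there)
import Data.List.Relation.Unary.Any as Any
open import Data.Product using (Σ; Σ-syntax; _×_; _,_; proj₁; proj₂)
open import Data.Empty using (⊥-elim)
open import Relation.Nullary using (Dec; yes; no; ¬_)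
open import Relation.Nullary.Decidable using (_×-dec_)
open import Relation.Binary.Definitions using (DecidableEquality)
open import Relation.Binary.PropositionalEquality using (_≡_; refl; cong; subst; sym)
open import Function.Bundles using (_⇔_)

record Alphabet : Set₁ where
  field
    Carrier  : Set
    _≟_      : DecidableEquality Carrier
    elems    : List Carrier
    complete : ∀ (a : Carrier) → a ∈ elems

open Alphabet public

Word : Alphabet → Set
Word A = List (Carrier A)

Lang : Alphabet → Set₁
Lang A = Word A → Set

record DFA (A : Alphabet) : Set where
  field
    states  : ℕ
    initial : Fin states
    δ       : Fin states → Carrier A → Fin states
    final   : Fin states → Bool

  accepts : Word A → Set
  accepts w = T (final (foldl δ initial w))

Regular : (A : Alphabet) → Lang A → Set
Regular A L = Σ[ M ∈ DFA A ] (∀ w → L w ⇔ DFA.accepts M w)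

record Class : Set₂ where
  field
    _∋_     : (A : Alphabet) → Lang A → Set
    regular : ∀ A L → A ∋ L → Regular A L

open Class public

record IsMonoidMorphism (A B : Alphabet) (α : Word A → Word B) : Set where
  field
    pres-ε : α [] ≡ []
    pres-∙ : ∀ u v → α (u ++ v) ≡ α u ++ α v

LengthIncreasing : (A B : Alphabet) → (Word A → Word B) → Set
LengthIncreasing A B α = IsMonoidMorphism A B α × (∀ a → ¬ (α (a ∷ []) ≡ []))

_⁻¹[_] : {A B : Alphabet} → (Word A → Word B) → Lang B → Lang A
(α ⁻¹[ L ]) w = L (α w)

ClosedUnderInvLIMorphisms : Class → Set₁
ClosedUnderInvLIMorphisms C =
  ∀ (A B : Alphabet) (α : Word A → Word B) → LengthIncreasing A B α →
  ∀ (L : Lang B) → (C ∋ B) L → (C ∋ A) (_⁻¹[_] {A} {B} α L)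

IsLetter : {X : Set} → ℕ → List X → Set
IsLetter d w = 1 ≤ length w × length w ≤ d

Letter : Alphabet → ℕ → Set
Letter A d = Σ[ w ∈ Word A ] IsLetter d w

private
  isLetter? : {X : Set} (d : ℕ) (w : List X) → Dec (IsLetter d w)
  isLetter? d w = (1 ≤? length w) ×-dec (length w ≤? d)

  isLetter-irr : {X : Set} {d : ℕ} {w : List X} (p q : IsLetter d w) → p ≡ q
  isLetter-irr (p₁ , p₂) (q₁ , q₂) with ≤-irrelevant p₁ q₁ | ≤-irrelevant p₂ q₂
  ... | refl | refl = refl

  letter-≟ : (A : Alphabet) (d : ℕ) → DecidableEquality (Letter A d)
  letter-≟ A d (u , p) (v , q) with LP.≡-dec (_≟_ A) u v
  ... | no u≢v = no λ eq → u≢v (cong proj₁ eq)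
  ... | yes refl with isLetter-irr {d = d} {w = u} p q
  ...   | refl = yes refl

  wordsUpTo : (A : Alphabet) → ℕ → List (Word A)
  wordsUpTo A zero    = [] ∷ []
  wordsUpTo A (suc n) = [] ∷ concatMap (λ a → map (a ∷_) (wordsUpTo A n)) (elems A)

  wordsUpTo-complete : (A : Alphabet) (n : ℕ) (w : Word A) → length w ≤ n → w ∈ wordsUpTo A n
  wordsUpTo-complete A zero    []      _       = here refl
  wordsUpTo-complete A (suc n) []      _       = here refl
  wordsUpTo-complete A (suc n) (a ∷ w) (s≤s l) =
    there (∈-concatMap⁺ (λ b → map (b ∷_) (wordsUpTo A n)) (Any.map (λ { refl → ∈-map⁺ (a ∷_) (wordsUpTo-complete A n w l) })
                                 (complete A a)))

  asLetter : (A : Alphabet) (d : ℕ) → Word A → List (Letter A d)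
  asLetter A d w with isLetter? d w
  ... | yes p = (w , p) ∷ []
  ... | no _  = []

  asLetter-complete : (A : Alphabet) (d : ℕ) (w : Word A) (p : IsLetter d w) → (w , p) ∈ asLetter A d w
  asLetter-complete A d w p with isLetter? d w
  ... | yes q = here (cong (w ,_) (isLetter-irr {d = d} {w = w} p q))
  ... | no ¬q = ⊥-elim (¬q p)

  letters : (A : Alphabet) (d : ℕ) → List (Letter A d)
  letters A d = concatMap (asLetter A d) (wordsUpTo A d)

  letters-complete : (A : Alphabet) (d : ℕ) (x : Letter A d) → x ∈ letters A d
  letters-complete A d (w , p) =
    ∈-concatMap⁺ (asLetter A d) (Any.map (λ { refl → asLetter-complete A d w p })
                          (wordsUpTo-complete A d w (proj₂ p)))

_^≤_ : Alphabet → ℕ → Alphabet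
A ^≤ d = record
  { Carrier  = Letter A d
  ; _≟_      = letter-≟ A d
  ; elems    = letters A d
  ; complete = letters-complete A d
  }

-- μ_d : A* → A_d*, cutting into consecutive factors of length d from
-- the left (last factor shorter, omitted if empty).  Defined for
-- d = suc k; the value for d = 0 is irrelevant (d ≥ 1 is always
-- required where μ_d is used).  `cut` uses fuel (length of the word),
-- which suffices since every step consumes at least one letter.

private
  take-letter : {X : Set} (k : ℕ) (x : X) (xs : List X) → IsLetter (suc k) (x ∷ take k xs)
  take-letter k x xs = s≤s z≤n , s≤s (≤-trans (≤-reflexive (length-take k xs)) (m⊓n≤m k (length xs)))

cut : {A : Alphabet} → ℕ → (k : ℕ) → Word A → List (Letter A (suc k))
cut zero    k w        = []
cut (suc n) k []       = []
cut {A} (suc n) k (x ∷ xs) = (x ∷ take k xs , take-letter k x xs) ∷ cut {A} n k (drop k xs)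

μ : {A : Alphabet} (d : ℕ) → Word A → Word (A ^≤ d)
μ zero    w = []
μ {A} (suc k) w = cut {A} (length w) k w

InBracketD : Class → ℕ → (A : Alphabet) → Lang A → Set₁
InBracketD C d A L =
  Σ[ K ∈ Lang (A ^≤ d) ] ((C ∋ (A ^≤ d)) K × (∀ w → L w ⇔ K (μ {A} d w)))

InBracket : Class → (A : Alphabet) → Lang A → Set₁
InBracket C A L = Σ[ d ∈ ℕ ] (1 ≤ d × InBracketD C d A L)

-- If d divides e, μ_d cuts every factor of length e produced by μ_e into e/d
-- factors of length d, so μ_d = recut_d ∘ μ_e, where the morphism
-- recut_d : A_e* → A_d* sends a letter u to μ_d(u).  It is length increasing,
-- hence μ_d⁻¹(K) = μ_e⁻¹(recut_d⁻¹(K)) shows [C]_d ⊆ [C]_e.  The product of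
-- the periods of L₁, …, L_m is then a common period.
module Submission where

open import Defs
open import Data.Nat using (ℕ; _≤_)
open import Data.Fin using (Fin)
open import Data.Product using (Σ-syntax; _×_)

open import Data.Nat using (zero; suc; _+_; _*_; _∸_; z≤n; s≤s; _≤?_)
open import Data.Nat.Properties
  using (≤-irrelevant; ≤-trans; ≤-refl; m∸n≤m; m≤m+n; m+n∸m≡n; m≤n⇒m⊓n≡m; m⊓n≤m; suc-injective; ≰⇒>; <⇒≤)
open import Data.Nat.Divisibility using (_∣_; divides; m∣m*n; n∣m*n)
open import Data.Fin using (zero; suc)
open import Data.List using (List; []; _∷_; _++_; length; take; drop; concatMap)
open import Data.List.Properties
  using (length-take; length-drop; take++drop≡id; take-all; drop-all; ++-identityʳ; concatMap-++)
open import Data.Product using (_,_; proj₁)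
open import Function using (_∘_)
open import Function.Bundles using (_⇔_)
open import Relation.Nullary using (¬_; yes; no)
open import Relation.Binary.PropositionalEquality
  using (_≡_; refl; sym; trans; cong; cong₂; subst; module ≡-Reasoning)
open ≡-Reasoning

take-++ˡ : {X : Set} (n : ℕ) (xs ys : List X) → n ≤ length xs → take n (xs ++ ys) ≡ take n xs
take-++ˡ zero    xs       ys _       = refl
take-++ˡ (suc n) (x ∷ xs) ys (s≤s p) = cong (x ∷_) (take-++ˡ n xs ys p)

drop-++ˡ : {X : Set} (n : ℕ) (xs ys : List X) → n ≤ length xs → drop n (xs ++ ys) ≡ drop n xs ++ ys
drop-++ˡ zero    xs       ys _       = refl
drop-++ˡ (suc n) (x ∷ xs) ys (s≤s p) = drop-++ˡ n xs ys p

length-drop-≤ : {X : Set} (n : ℕ) (xs : List X) → length (drop n xs) ≤ length xs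
length-drop-≤ n xs = subst (_≤ length xs) (sym (length-drop n xs)) (m∸n≤m (length xs) n)

length-take-≤ : {X : Set} (n : ℕ) (xs : List X) → length (take n xs) ≤ n
length-take-≤ n xs = subst (_≤ n) (sym (length-take n xs)) (m⊓n≤m n (length xs))

letter-≡ : {A : Alphabet} {d : ℕ} {l l′ : Letter A d} → proj₁ l ≡ proj₁ l′ → l ≡ l′
letter-≡ {l = w , p₁ , p₂} {l′ = .w , q₁ , q₂} refl
  rewrite ≤-irrelevant p₁ q₁ | ≤-irrelevant p₂ q₂ = refl

module _ {A : Alphabet} where

  cut-fuel-irrelevant : (n n′ k : ℕ) (w : Word A) → length w ≤ n → length w ≤ n′ →
    cut {A} n k w ≡ cut {A} n′ k w
  cut-fuel-irrelevant zero    zero     k w        _       _        = refl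
  cut-fuel-irrelevant zero    (suc n′) k []       _       _        = refl
  cut-fuel-irrelevant (suc n) zero     k []       _       _        = refl
  cut-fuel-irrelevant (suc n) (suc n′) k []       _       _        = refl
  cut-fuel-irrelevant (suc n) (suc n′) k (x ∷ xs) (s≤s p) (s≤s p′) =
    cong (_ ∷_) (cut-fuel-irrelevant n n′ k (drop k xs)
                  (≤-trans (length-drop-≤ k xs) p) (≤-trans (length-drop-≤ k xs) p′))

  firstBlock : (k : ℕ) → Carrier A → Word A → Letter A (suc k)
  firstBlock k x xs = x ∷ take k xs , s≤s z≤n , s≤s (length-take-≤ k xs)

  μ-∷ : (k : ℕ) (x : Carrier A) (xs : Word A) →
    μ {A} (suc k) (x ∷ xs) ≡ firstBlock k x xs ∷ μ {A} (suc k) (drop k xs)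
  μ-∷ k x xs = cong₂ _∷_ (letter-≡ {A} {suc k} refl)
    (cut-fuel-irrelevant (length xs) (length (drop k xs)) k (drop k xs) (length-drop-≤ k xs) ≤-refl)

  μ-++ : (a j : ℕ) (u v : Word A) → length u ≡ j * suc a →
    μ {A} (suc a) (u ++ v) ≡ μ {A} (suc a) u ++ μ {A} (suc a) v
  μ-++ a zero    []       v _   = refl
  μ-++ a (suc j) (x ∷ xs) v len = begin
    μ {A} (suc a) (x ∷ xs ++ v)
      ≡⟨ μ-∷ a x (xs ++ v) ⟩
    firstBlock a x (xs ++ v) ∷ μ {A} (suc a) (drop a (xs ++ v))
      ≡⟨ cong₂ _∷_ (letter-≡ {A} {suc a} (cong (x ∷_) (take-++ˡ a xs v a≤∣xs∣)))
                   (cong (μ {A} (suc a)) (drop-++ˡ a xs v a≤∣xs∣)) ⟩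
    firstBlock a x xs ∷ μ {A} (suc a) (drop a xs ++ v)
      ≡⟨ cong (firstBlock a x xs ∷_) (μ-++ a j (drop a xs) v ∣drop∣≡) ⟩
    firstBlock a x xs ∷ μ {A} (suc a) (drop a xs) ++ μ {A} (suc a) v
      ≡⟨ cong (_++ μ {A} (suc a) v) (sym (μ-∷ a x xs)) ⟩
    μ {A} (suc a) (x ∷ xs) ++ μ {A} (suc a) v ∎
    where
    ∣xs∣≡ : length xs ≡ a + j * suc a
    ∣xs∣≡ = suc-injective len
    a≤∣xs∣ : a ≤ length xs
    a≤∣xs∣ = subst (a ≤_) (sym ∣xs∣≡) (m≤m+n a (j * suc a))
    ∣drop∣≡ : length (drop a xs) ≡ j * suc a
    ∣drop∣≡ = trans (length-drop a xs) (trans (cong (_∸ a) ∣xs∣≡) (m+n∸m≡n a (j * suc a)))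

  μ-take++drop : (a e : ℕ) → suc a ∣ e → (w : Word A) →
    μ {A} (suc a) w ≡ μ {A} (suc a) (take e w) ++ μ {A} (suc a) (drop e w)
  μ-take++drop a e (divides j e≡) w with e ≤? length w
  ... | yes e≤∣w∣ = begin
    μ {A} (suc a) w
      ≡⟨ cong (μ {A} (suc a)) (sym (take++drop≡id e w)) ⟩
    μ {A} (suc a) (take e w ++ drop e w)
      ≡⟨ μ-++ a j (take e w) (drop e w) (trans (length-take e w) (trans (m≤n⇒m⊓n≡m e≤∣w∣) e≡)) ⟩
    μ {A} (suc a) (take e w) ++ μ {A} (suc a) (drop e w) ∎
  ... | no e≰∣w∣ = begin
    μ {A} (suc a) w
      ≡⟨ sym (++-identityʳ _) ⟩
    μ {A} (suc a) w ++ μ {A} (suc a) []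
      ≡⟨ sym (cong₂ (λ u v → μ {A} (suc a) u ++ μ {A} (suc a) v) (take-all e w ∣w∣≤e) (drop-all e w ∣w∣≤e)) ⟩
    μ {A} (suc a) (take e w) ++ μ {A} (suc a) (drop e w) ∎
    where
    ∣w∣≤e : length w ≤ e
    ∣w∣≤e = <⇒≤ (≰⇒> e≰∣w∣)

  recut : (d : ℕ) {e : ℕ} → Word (A ^≤ e) → Word (A ^≤ d)
  recut d = concatMap (μ {A} d ∘ proj₁)

  recut-lengthIncreasing : (a e : ℕ) → LengthIncreasing (A ^≤ e) (A ^≤ suc a) (recut (suc a))
  recut-lengthIncreasing a e =
    record { pres-ε = refl ; pres-∙ = concatMap-++ (μ {A} (suc a) ∘ proj₁) } , nonempty
    where
    nonempty : ∀ l → ¬ recut (suc a) (l ∷ []) ≡ []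
    nonempty ([] , () , _)
    nonempty ((x ∷ xs) , _) ()

  μ-recut : (a b : ℕ) → suc a ∣ suc b → (w : Word A) →
    μ {A} (suc a) w ≡ recut (suc a) (μ {A} (suc b) w)
  μ-recut a b d∣e w = go (length w) w ≤-refl
    where
    go : (n : ℕ) (w : Word A) → length w ≤ n → μ {A} (suc a) w ≡ recut (suc a) (μ {A} (suc b) w)
    go n       []       _       = refl
    go (suc n) (x ∷ xs) (s≤s p) = begin
      μ {A} (suc a) (x ∷ xs)
        ≡⟨ μ-take++drop a (suc b) d∣e (x ∷ xs) ⟩
      μ {A} (suc a) (x ∷ take b xs) ++ μ {A} (suc a) (drop b xs)
        ≡⟨ cong (μ {A} (suc a) (x ∷ take b xs) ++_) (go n (drop b xs) (≤-trans (length-drop-≤ b xs) p)) ⟩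
      μ {A} (suc a) (x ∷ take b xs) ++ recut (suc a) (μ {A} (suc b) (drop b xs))
        ≡⟨ cong (recut (suc a)) (sym (μ-∷ b x xs)) ⟩
      recut (suc a) (μ {A} (suc b) (x ∷ xs)) ∎

InBracketD-∣ : (C : Class) → ClosedUnderInvLIMorphisms C → (A : Alphabet) (L : Lang A) (a b : ℕ) →
  suc a ∣ suc b → InBracketD C (suc a) A L → InBracketD C (suc b) A L
InBracketD-∣ C closed A L a b d∣e (K , K∈C , L⇔K) =
  _⁻¹[_] {A ^≤ suc b} {A ^≤ suc a} (recut (suc a)) K ,
  closed (A ^≤ suc b) (A ^≤ suc a) (recut (suc a)) (recut-lengthIncreasing a (suc b)) K K∈C ,
  λ w → subst (λ u → L w ⇔ K u) (μ-recut a b d∣e w) (L⇔K w)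

commonPeriod : (C : Class) → ClosedUnderInvLIMorphisms C → (A : Alphabet) (m : ℕ) (L : Fin m → Lang A) →
  (∀ i → InBracket C A (L i)) → Σ[ d ∈ ℕ ] (1 ≤ d × (∀ i → InBracketD C d A (L i)))
commonPeriod C closed A zero    L _ = 1 , s≤s z≤n , λ ()
commonPeriod C closed A (suc m) L L∈C
  with L∈C zero | commonPeriod C closed A m (L ∘ suc) (L∈C ∘ suc)
... | suc a , _ , L₀∈C | suc b , _ , L′∈C = suc a * suc b , s≤s z≤n , L∈Cd
  where
  L∈Cd : ∀ i → InBracketD C (suc a * suc b) A (L i)
  L∈Cd zero    = InBracketD-∣ C closed A (L zero) a _ (m∣m*n (suc b)) L₀∈C
  L∈Cd (suc i) = InBracketD-∣ C closed A (L (suc i)) b _ (n∣m*n (suc a)) (L′∈C i)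

corollary6p4 : (C : Class) → ClosedUnderInvLIMorphisms C →
    (A : Alphabet) (m : ℕ) → 1 ≤ m → (L : Fin m → Lang A) →
    (∀ i → InBracket C A (L i)) →
    Σ[ d ∈ ℕ ] (1 ≤ d × (∀ i → InBracketD C d A (L i)))
corollary6p4 C closed A m _ = commonPeriod C closed A m
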